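{- Let $\ell\ge1$ and $p,q\in\mathbb{N}$. The set $\Psi(\mathrm{rep}_\ell(q+\mathbb{N}p))\subseteq\mathbb{N}^\ell$ is a finite union of linear sets of the form $\mathbf{x}+\mathbb{N}P\mathbf{e}_1+\cdots+\mathbb{N}P\mathbf{e}_\ell$ for some $P\in\mathbb{N}$.
   Context: For $\ell\ge1$ let $\Sigma_\ell=\{a_1<\cdots<a_\ell\}$ and $\mathcal{B}_\ell=a_1^*\cdots a_\ell^*$. For $n\ge0$, $\mathrm{rep}_\ell(n)$ is the $(n+1)$-st word of $\mathcal{B}_\ell$ in genealogical order (shorter words first; equal-length words ordered lexicographically). $q+\mathbb{N}p=\{q+np:n\in\mathbb{N}\}$. The Parikh map is $\Psi(w)=(|w|_{a_1},\ldots,|w|_{a_\ell})$, where $|w|_{a_j}$ counts occurrences of $a_j$ in $w$. $\mathbf{e}_i\in\mathbb{N}^\ell$ is the $i$-th canonical vector, and $\mathbf{x}+\mathbb{N}P\mathbf{e}_1+\cdots+\mathbb{N}P\mathbf{e}_\ell=\{\mathbf{x}+\sum_i n_iP\mathbf{e}_i: n_i\in\mathbb{N}\}$. -}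

module Defs where

open import Data.Nat using (ℕ; _+_; _*_; _<_)
open import Data.Fin using (Fin; _≟_)
import Data.Fin as Fin
open import Data.List using (List; length; filter)
open import Data.List.Relation.Unary.Linked using (Linked)
open import Data.List.Relation.Binary.Lex.Strict using (Lex-<)
open import Data.Vec using (Vec; tabulate; zipWith; map)
open import Data.Product using (Σ; _×_)
open import Data.Sum using (_⊎_)
open import Function.Bundles using (_↔_)
open import Relation.Binary.PropositionalEquality using (_≡_)

-- Words over Σ_ℓ = {a_1 < ... < a_ℓ}; the letter a_{i+1} is represented by i : Fin ℓ.
Word : ℕ → Set
Word ℓ = List (Fin ℓ)

-- Membership in B_ℓ = a_1^* ... a_ℓ^* : the letters are non-decreasing.
InB : {ℓ : ℕ} → Word ℓ → Set
InB w = Linked Fin._≤_ w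

_<gen_ : {ℓ : ℕ} → Word ℓ → Word ℓ → Set
v <gen w = (length v < length w) ⊎ ((length v ≡ length w) × Lex-< _≡_ Fin._<_ v w)

-- IsRep ℓ n w : w = rep_ℓ(n), i.e. w ∈ B_ℓ and exactly n words of B_ℓ
-- precede w in genealogical order (w is the (n+1)-st word of B_ℓ).
IsRep : (ℓ n : ℕ) → Word ℓ → Set
IsRep ℓ n w = InB w × (Fin n ↔ Σ (Word ℓ) (λ v → InB v × v <gen w))

Ψ : {ℓ : ℕ} → Word ℓ → Vec ℕ ℓ
Ψ {ℓ} w = tabulate (λ j → length (filter (j ≟_) w))

InΨrep : (ℓ p q : ℕ) → Vec ℕ ℓ → Set
InΨrep ℓ p q v = Σ ℕ (λ n → Σ (Word ℓ) (λ w → IsRep ℓ (q + n * p) w × Ψ w ≡ v))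

InLinear : {ℓ : ℕ} → ℕ → Vec ℕ ℓ → Vec ℕ ℓ → Set
InLinear {ℓ} P x v = Σ (Vec ℕ ℓ) (λ ns → v ≡ zipWith _+_ x (map (P *_) ns))

module Submission where

-- Write word v = a₁^{v₁} ⋯ a_ℓ^{v_ℓ}; this is a bijection from
-- ℕ^ℓ onto B_ℓ inverse to Ψ.  Its position in B_ℓ in genealogical order is
-- the explicit number rank v = Σ_{i < |v|} G(i) + rank(tail v), where G(i)
-- counts the vectors of ℕ^{ℓ-1} of size ≤ i.  Hence Ψ(rep_ℓ(q + ℕp)) is the
-- preimage of the progression q + ℕp under rank.  The partial sums of a
-- function with period Q modulo p have period pQ modulo p, so by induction on
-- ℓ the rank satisfies rank x ≡ rank (x + p^ℓ·ns) (mod p), and the values grow.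
-- A general criterion then shows that the preimage of q + ℕp under any such
-- "periodic" size-dominating f : ℕ^ℓ → ℕ is the union of the linear sets
-- x + (Pℕ)^ℓ with representatives x in the box [0, q + P]^ℓ: reduce a point
-- modulo (Pℕ)^ℓ without lowering coordinates below q.

open import Defs
open import Data.Nat using (ℕ; zero; suc; _+_; _*_; _∸_; _^_; _≤_; _<_; _≥_; z≤n; s≤s; _<?_; _≤?_; NonZero)
open import Data.Nat.Properties hiding (_≟_)
open import Data.Nat.DivMod using (_%_; _/_; m≡m%n+[m/n]*n; m%n<n)
open import Data.Nat.Divisibility using (_∣_; divides; _∣?_)
open import Data.Nat.Tactic.RingSolver using (solve-∀)
open import Data.Fin as Fin using (Fin; _≟_; toℕ; fromℕ<) renaming (zero to fzero; suc to fsuc)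
import Data.Fin.Properties as Finₚ
open import Data.Fin.Permutation using (↔⇒≡)
open import Data.List as List using (List; []; _∷_; _++_; replicate; length; filter; upTo; cartesianProductWith)
open import Data.List.Properties using (length-++; length-replicate; length-map)
open import Data.List.Membership.Propositional using (_∈_)
open import Data.List.Membership.Propositional.Properties using (∈-filter⁺; ∈-filter⁻; ∈-cartesianProductWith⁺; ∈-upTo⁺)
open import Data.List.Relation.Unary.Any using (here)
open import Data.List.Relation.Unary.Linked as Linked using ([]; [-]; _∷_)
open import Data.List.Relation.Unary.Linked.Properties using () renaming (map⁺ to Linked-map⁺)
open import Data.List.Relation.Binary.Lex.Strict using (Lex-<; base; halt; this; next; <-asymmetric)
open import Data.Vec as Vec using (Vec; []; _∷_; zipWith; sum)
open import Data.Vec.Properties using (tabulate-cong)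
open import Data.Vec.Relation.Unary.All using (All; []; _∷_)
open import Data.Product using (Σ; _×_; _,_; proj₁; proj₂)
open import Data.Sum using (_⊎_; inj₁; inj₂)
open import Data.Empty using (⊥-elim)
open import Function using (_∘_)
open import Function.Bundles using (_↔_; _⇔_; mk⇔; mk↔ₛ′; Equivalence)
open import Function.Properties.Inverse using (↔-trans; ↔-sym)
open import Relation.Binary.PropositionalEquality
open import Relation.Binary.Definitions using (tri<; tri≈; tri>)
open import Relation.Nullary using (¬_)
open import Relation.Nullary.Decidable using (Dec; yes; no; _×-dec_; map′)
import Axiom.UniquenessOfIdentityProofs as UIP

private variable
  a b c d n p q Q : ℕ
  f g : ℕ → ℕ

-- a ≼[ p ] b : b lies in the progression a + ℕp.  A preorder compatible with
-- +; all congruences modulo p in the proof are stated with it, since they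
-- come together with the inequality a ≤ b.
infix 4 _≼[_]_
_≼[_]_ : ℕ → ℕ → ℕ → Set
a ≼[ p ] b = Σ ℕ λ d → b ≡ a + d * p

≼-reflexive : a ≡ b → a ≼[ p ] b
≼-reflexive {a} refl = 0 , sym (+-identityʳ a)

≼-refl : a ≼[ p ] a
≼-refl = ≼-reflexive refl

≼-trans : a ≼[ p ] b → b ≼[ p ] c → a ≼[ p ] c
≼-trans {a} {p = p} (x , refl) (y , refl) = x + y , shift-twice a x y p
  where
  shift-twice : ∀ a x y p → (a + x * p) + y * p ≡ a + (x + y) * p
  shift-twice = solve-∀

≼-+ : a ≼[ p ] b → c ≼[ p ] d → a + c ≼[ p ] b + d
≼-+ {a = a} {p = p} {c = c} (x , refl) (y , refl) = x + y , shift-sum a x c y p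
  where
  shift-sum : ∀ a x c y p → (a + x * p) + (c + y * p) ≡ (a + c) + (x + y) * p
  shift-sum = solve-∀

≼-+-multiple : ∀ a k → a ≼[ p ] a + p * k
≼-+-multiple {p} a k = k , cong (a +_) (*-comm p k)

≼⇒≤×∣ : a ≼[ p ] b → a ≤ b × p ∣ b ∸ a
≼⇒≤×∣ {a} {p} (d , refl) = m≤m+n a (d * p) , divides d (m+n∸m≡n a (d * p))

≤×∣⇒≼ : a ≤ b × p ∣ b ∸ a → a ≼[ p ] b
≤×∣⇒≼ {a} (a≤b , divides d b∸a≡d*p) = d , trans (sym (m+[n∸m]≡n a≤b)) (cong (a +_) b∸a≡d*p)

_≼?[_]_ : ∀ a p b → Dec (a ≼[ p ] b)
a ≼?[ p ] b = map′ ≤×∣⇒≼ ≼⇒≤×∣ ((a ≤? b) ×-dec (p ∣? (b ∸ a)))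

≼-between : q ≼[ p ] b → a ≼[ p ] b → q ≤ a → q ≼[ p ] a
≼-between {q} {p} {b} {a} (n , b≡) (d , refl) q≤a = n ∸ d , (begin
  a                        ≡⟨ m+[n∸m]≡n q≤a ⟨
  q + r                    ≡⟨ cong (q +_) r≡ ⟩
  q + (n ∸ d) * p          ∎)
  where
  open ≡-Reasoning
  r : ℕ
  r = a ∸ q
  r+dp≡np : r + d * p ≡ n * p
  r+dp≡np = +-cancelˡ-≡ q _ _ (trans (sym (+-assoc q r (d * p)))
              (trans (cong (_+ d * p) (m+[n∸m]≡n q≤a)) b≡))
  r≡ : r ≡ (n ∸ d) * p
  r≡ = begin
    r                      ≡⟨ m+n∸n≡m r (d * p) ⟨
    r + d * p ∸ d * p      ≡⟨ cong (_∸ d * p) r+dp≡np ⟩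
    n * p ∸ d * p          ≡⟨ *-distribʳ-∸ p n d ⟨
    (n ∸ d) * p            ∎

sumBelow : ℕ → (ℕ → ℕ) → ℕ
sumBelow zero    f = 0
sumBelow (suc n) f = sumBelow n f + f n

sumBelow-≼ : (∀ i → f i ≼[ p ] g i) → sumBelow n f ≼[ p ] sumBelow n g
sumBelow-≼ {n = zero}  f≼g = ≼-refl
sumBelow-≼ {n = suc n} f≼g = ≼-+ (sumBelow-≼ {n = n} f≼g) (f≼g n)

sumBelow-+ : ∀ m n f → sumBelow (m + n) f ≡ sumBelow m f + sumBelow n (λ i → f (m + i))
sumBelow-+ m zero    f = trans (cong (λ z → sumBelow z f) (+-identityʳ m)) (sym (+-identityʳ _))
sumBelow-+ m (suc n) f = begin
  sumBelow (m + suc n) f                                           ≡⟨ cong (λ z → sumBelow z f) (+-suc m n) ⟩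
  sumBelow (m + n) f + f (m + n)                                   ≡⟨ cong (_+ f (m + n)) (sumBelow-+ m n f) ⟩
  sumBelow m f + sumBelow n (λ i → f (m + i)) + f (m + n)          ≡⟨ +-assoc (sumBelow m f) _ _ ⟩
  sumBelow m f + sumBelow (suc n) (λ i → f (m + i))                ∎
  where open ≡-Reasoning

Periodic : ℕ → ℕ → (ℕ → ℕ) → Set
Periodic p Q g = ∀ k → g k ≼[ p ] g (k + Q)

periodic-multiple : Periodic p Q g → ∀ c k → g k ≼[ p ] g (k + c * Q)
periodic-multiple {g = g} per zero    k = ≼-reflexive (cong g (sym (+-identityʳ k)))
periodic-multiple {Q = Q} {g = g} per (suc c) k =
  ≼-trans (per k) (≼-trans (periodic-multiple per c (k + Q)) (≼-reflexive (cong g (+-assoc k Q (c * Q)))))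

-- The p consecutive blocks of length Q are all congruent to the
-- first block B, so together they contribute p·B ≡ 0.
sumBelow-periodic : Periodic p Q g → Periodic p (p * Q) (λ m → sumBelow m g)
sumBelow-periodic {p} {Q} {g} per m =
  ≼-trans (≼-+-multiple (sumBelow m g) (block m)) (blocks p)
  where
  block : ℕ → ℕ
  block a = sumBelow Q (λ i → g (a + i))

  block-periodic : Periodic p Q block
  block-periodic a = sumBelow-≼ {n = Q} λ i → subst (λ z → g (a + i) ≼[ p ] g z) (reorder a i Q) (per (a + i))
    where
    reorder : ∀ a i Q → a + i + Q ≡ a + Q + i
    reorder = solve-∀

  blocks : ∀ n → sumBelow m g + n * block m ≼[ p ] sumBelow (m + n * Q) g
  blocks zero    = ≼-reflexive (trans (+-identityʳ _) (cong (λ z → sumBelow z g) (sym (+-identityʳ m))))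
  blocks (suc n) = subst₂ _≼[ p ]_ (regroup (sumBelow m g) (n * block m) (block m))
    (trans (sym (sumBelow-+ (m + n * Q) Q g)) (cong (λ z → sumBelow z g) (regroup m (n * Q) Q)))
    (≼-+ (blocks n) (periodic-multiple block-periodic n m))
    where
    regroup : ∀ x y z → x + y + z ≡ x + (z + y)
    regroup = solve-∀

translate : ∀ {ℓ} → ℕ → Vec ℕ ℓ → Vec ℕ ℓ → Vec ℕ ℓ
translate M x ns = zipWith _+_ x (Vec.map (M *_) ns)

translate-zero : ∀ {ℓ} P (x : Vec ℕ ℓ) → x ≡ translate P x (Vec.replicate ℓ 0)
translate-zero P []      = refl
translate-zero P (a ∷ x) =
  cong₂ _∷_ (sym (trans (cong (a +_) (*-zeroʳ P)) (+-identityʳ a))) (translate-zero P x)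

box : ∀ ℓ → ℕ → List (Vec ℕ ℓ)
box zero    B = [] ∷ []
box (suc ℓ) B = cartesianProductWith _∷_ (upTo (suc B)) (box ℓ B)

∈-box : ∀ {ℓ B} {x : Vec ℕ ℓ} → All (_≤ B) x → x ∈ box ℓ B
∈-box []         = here refl
∈-box (a≤B ∷ t≤B) = ∈-cartesianProductWith⁺ _∷_ (∈-upTo⁺ (s≤s a≤B)) (∈-box t≤B)

bounded-by-sum : ∀ {ℓ B} (v : Vec ℕ ℓ) → sum v ≤ B → All (_≤ B) v
bounded-by-sum []      _    = []
bounded-by-sum (a ∷ t) s≤B =
  ≤-trans (m≤m+n a (sum t)) s≤B ∷ bounded-by-sum t (≤-trans (m≤n+m (sum t) a) s≤B)

module Reduction (q P : ℕ) .{{_ : NonZero P}} where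

  reduce : ∀ a → Σ ℕ λ r → Σ ℕ λ k → a ≡ r + P * k × r ≤ q + P × (r ≡ a ⊎ q ≤ r)
  reduce a with a <? q
  ... | yes a<q = a , 0 , sym (trans (cong (a +_) (*-zeroʳ P)) (+-identityʳ a)) ,
                  ≤-trans (<⇒≤ a<q) (m≤m+n q P) , inj₁ refl
  ... | no  a≮q = q + (a ∸ q) % P , (a ∸ q) / P , a≡ ,
                  +-monoʳ-≤ q (<⇒≤ (m%n<n (a ∸ q) P)) , inj₂ (m≤m+n q _)
    where
    open ≡-Reasoning
    regroup : ∀ q r k P → q + (r + k * P) ≡ q + r + P * k
    regroup = solve-∀
    a≡ : a ≡ q + (a ∸ q) % P + P * ((a ∸ q) / P)
    a≡ = begin
      a                                              ≡⟨ m+[n∸m]≡n (≮⇒≥ a≮q) ⟨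
      q + (a ∸ q)                                    ≡⟨ cong (q +_) (m≡m%n+[m/n]*n (a ∸ q) P) ⟩
      q + ((a ∸ q) % P + (a ∸ q) / P * P)            ≡⟨ regroup q _ _ P ⟩
      q + (a ∸ q) % P + P * ((a ∸ q) / P)            ∎

  reduce-vector : ∀ {ℓ} (v : Vec ℕ ℓ) → Σ (Vec ℕ ℓ) λ x → Σ (Vec ℕ ℓ) λ ns →
    v ≡ translate P x ns × All (_≤ q + P) x × (x ≡ v ⊎ q ≤ sum x)
  reduce-vector []      = [] , [] , refl , [] , inj₁ refl
  reduce-vector (a ∷ t) with reduce a | reduce-vector t
  ... | r , k , a≡ , r≤ , r-kept | x , ns , t≡ , x≤ , x-kept =
    r ∷ x , k ∷ ns , cong₂ _∷_ a≡ t≡ , r≤ ∷ x≤ , combine r-kept x-kept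
    where
    combine : r ≡ a ⊎ q ≤ r → x ≡ t ⊎ q ≤ sum x → r ∷ x ≡ a ∷ t ⊎ q ≤ r + sum x
    combine (inj₁ r≡a) (inj₁ x≡t) = inj₁ (cong₂ _∷_ r≡a x≡t)
    combine (inj₂ q≤r) _          = inj₂ (≤-trans q≤r (m≤m+n r (sum x)))
    combine (inj₁ _)   (inj₂ q≤x) = inj₂ (≤-trans q≤x (m≤n+m (sum x) r))

-- Completeness needs P ≠ 0 or p = 0; in the latter
-- case f⁻¹(q) already lies in the box, since f bounds the size.
module PeriodicPreimage {ℓ : ℕ} (p q P : ℕ) (f : Vec ℕ ℓ → ℕ)
  (f-periodic : ∀ x ns → f x ≼[ p ] f (translate P x ns))
  (size≤f : ∀ v → sum v ≤ f v) where

  representatives : List (Vec ℕ ℓ)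
  representatives = filter (λ x → q ≼?[ p ] f x) (box ℓ (q + P))

  sound : ∀ v → Σ (Vec ℕ ℓ) (λ x → x ∈ representatives × InLinear P x v) → q ≼[ p ] f v
  sound v (x , x∈ , ns , refl) =
    ≼-trans (proj₂ (∈-filter⁻ (λ x → q ≼?[ p ] f x) {xs = box ℓ (q + P)} x∈)) (f-periodic x ns)

  complete : p ≡ 0 ⊎ NonZero P → ∀ v → q ≼[ p ] f v →
    Σ (Vec ℕ ℓ) (λ x → x ∈ representatives × InLinear P x v)
  complete (inj₁ refl) v q≼fv@(d , fv≡) =
    v , ∈-filter⁺ (λ x → q ≼?[ p ] f x) (∈-box (bounded-by-sum v size≤q+P)) q≼fv ,
    Vec.replicate ℓ 0 , translate-zero P v
    where
    size≤q+P : sum v ≤ q + P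
    size≤q+P = ≤-trans (size≤f v)
      (≤-trans (≤-reflexive (trans fv≡ (trans (cong (q +_) (*-zeroʳ d)) (+-identityʳ q)))) (m≤m+n q P))
  complete (inj₂ P≢0) v q≼fv with Reduction.reduce-vector q P {{P≢0}} v
  ... | x , ns , refl , x≤ , kept =
    x , ∈-filter⁺ (λ x → q ≼?[ p ] f x) (∈-box x≤) (≼-between q≼fv (f-periodic x ns) (q≤fx kept)) , ns , refl
    where
    q≤fx : x ≡ translate P x ns ⊎ q ≤ sum x → q ≤ f x
    q≤fx (inj₁ x≡v) = subst (λ z → q ≤ f z) (sym x≡v) (proj₁ (≼⇒≤×∣ q≼fv))
    q≤fx (inj₂ q≤x) = ≤-trans q≤x (size≤f x)

word : ∀ {ℓ} → Vec ℕ ℓ → Word ℓ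
word []      = []
word (a ∷ t) = replicate a fzero ++ List.map fsuc (word t)

length-word : ∀ {ℓ} (v : Vec ℕ ℓ) → length (word v) ≡ sum v
length-word []      = refl
length-word (a ∷ t) = trans (length-++ (replicate a fzero))
  (cong₂ _+_ (length-replicate a) (trans (length-map fsuc (word t)) (length-word t)))

Ψ-prepend : ∀ {ℓ} (a : ℕ) (x : Word ℓ) → Ψ (replicate a fzero ++ List.map fsuc x) ≡ a ∷ Ψ x
Ψ-prepend {ℓ} a x = cong₂ _∷_ (count-first a) (tabulate-cong (count-shifted a))
  where
  count-first : ∀ a → length (filter (fzero ≟_) (replicate a fzero ++ List.map fsuc x)) ≡ a
  count-first zero    = no-first x
    where
    no-first : ∀ (y : Word ℓ) → length (filter (fzero ≟_) (List.map fsuc y)) ≡ 0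
    no-first []      = refl
    no-first (_ ∷ y) = no-first y
  count-first (suc a) = cong suc (count-first a)

  count-shifted : ∀ a (j : Fin ℓ) →
    length (filter (fsuc j ≟_) (replicate a fzero ++ List.map fsuc x)) ≡ length (filter (j ≟_) x)
  count-shifted zero    j = shift-invariant x
    where
    shift-invariant : ∀ y → length (filter (fsuc j ≟_) (List.map fsuc y)) ≡ length (filter (j ≟_) y)
    shift-invariant []      = refl
    shift-invariant (y ∷ ys) with j ≟ y
    ... | yes _ = cong suc (shift-invariant ys)
    ... | no  _ = shift-invariant ys
  count-shifted (suc a) j = count-shifted a j

Ψ-word : ∀ {ℓ} (v : Vec ℕ ℓ) → Ψ (word v) ≡ v
Ψ-word []      = refl
Ψ-word (a ∷ t) = trans (Ψ-prepend a (word t)) (cong (a ∷_) (Ψ-word t))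

InB-prepend : ∀ {ℓ} (a : ℕ) {x : Word (suc ℓ)} → InB x → InB (replicate a fzero ++ x)
InB-prepend zero          x↗ = x↗
InB-prepend (suc zero) {[]}    x↗ = [-]
InB-prepend (suc zero) {_ ∷ _} x↗ = z≤n ∷ x↗
InB-prepend (suc (suc a)) x↗ = z≤n ∷ InB-prepend (suc a) x↗

InB-shift : ∀ {ℓ} {x : Word ℓ} → InB x → InB (List.map fsuc x)
InB-shift x↗ = Linked-map⁺ (Linked.map s≤s x↗)

InB-word : ∀ {ℓ} (v : Vec ℕ ℓ) → InB (word v)
InB-word []      = []
InB-word (a ∷ t) = InB-prepend a (InB-shift (InB-word t))

data FirstLetterSplit {ℓ} : Word (suc ℓ) → Set where
  split : (a : ℕ) (x : Word ℓ) → InB x → FirstLetterSplit (replicate a fzero ++ List.map fsuc x)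

shifted : ∀ {ℓ} (i : Fin ℓ) (w : Word (suc ℓ)) → InB (fsuc i ∷ w) →
  Σ (Word ℓ) λ x → fsuc i ∷ w ≡ List.map fsuc x × InB x
shifted i []           _             = i ∷ [] , refl , [-]
shifted i (fzero ∷ w)  (() ∷ _)
shifted i (fsuc j ∷ w) (s≤s i≤j ∷ w↗) with shifted j w w↗
... | j ∷ x , refl , x↗ = i ∷ j ∷ x , refl , i≤j ∷ x↗

first-letter-split : ∀ {ℓ} (w : Word (suc ℓ)) → InB w → FirstLetterSplit w
first-letter-split []          _  = split 0 [] []
first-letter-split (fzero ∷ w) w↗ with first-letter-split w (Linked.tail w↗)
... | split a x x↗ = split (suc a) x x↗
first-letter-split (fsuc i ∷ w) w↗ with shifted i w w↗
... | x , e , x↗ rewrite e = split 0 x x↗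

word-Ψ : ∀ {ℓ} (w : Word ℓ) → InB w → w ≡ word (Ψ w)
word-Ψ {zero}  []    _  = refl
word-Ψ {suc ℓ} w     w↗ with first-letter-split w w↗
... | split a x x↗ = trans (cong (λ z → replicate a fzero ++ List.map fsuc z) (word-Ψ x x↗))
                           (cong word (sym (Ψ-prepend a x)))

monotone-by-steps : ∀ (f : ℕ → ℕ) → (∀ k → f k ≤ f (suc k)) → ∀ {m n} → m ≤ n → f m ≤ f n
monotone-by-steps f step {n = zero}  z≤n = ≤-refl
monotone-by-steps f step {n = suc n} m≤1+n with m≤n⇒m<n∨m≡n m≤1+n
... | inj₁ (s≤s m≤n) = ≤-trans (monotone-by-steps f step m≤n) (step n)
... | inj₂ refl      = ≤-refl

-- G ℓ k = #{v ∈ ℕ^ℓ : |v| ≤ k}, so that sumBelow n (G ℓ) = #{v ∈ ℕ^{ℓ+1} : |v| < n}.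
G : ℕ → ℕ → ℕ
G zero    k = 1
G (suc ℓ) k = sumBelow (suc k) (G ℓ)

G-positive : ∀ ℓ k → 1 ≤ G ℓ k
G-positive zero    k = ≤-refl
G-positive (suc ℓ) k = ≤-trans (G-positive ℓ k) (m≤n+m _ _)

G-monotone : ∀ ℓ {m n} → m ≤ n → G ℓ m ≤ G ℓ n
G-monotone zero    _ = ≤-refl
G-monotone (suc ℓ)   = monotone-by-steps (G (suc ℓ)) (λ k → m≤m+n _ _)

-- rank v is the index of word v in B_ℓ: for v = (a, t) the words preceding it
-- are the sumBelow |v| (G ℓ) shorter ones, and those of the same length with
-- more a₁'s, i.e. the (b, s) with |s| < |t|, plus those with b = a and s
-- preceding t; the last two kinds number rank t.
rank : ∀ {ℓ} → Vec ℕ ℓ → ℕ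
rank []              = 0
rank {suc ℓ} (a ∷ t) = sumBelow (a + sum t) (G ℓ) + rank t

-- Only vectors of size ≤ |v| precede v.
rank-bound : ∀ {ℓ} (v : Vec ℕ ℓ) → rank v < G ℓ (sum v)
rank-bound []              = s≤s z≤n
rank-bound {suc ℓ} (a ∷ t) =
  +-monoʳ-< (sumBelow (a + sum t) (G ℓ)) (≤-trans (rank-bound t) (G-monotone ℓ (m≤n+m (sum t) a)))

rank-size-separated : ∀ {ℓ} (u v : Vec ℕ (suc ℓ)) → sum u < sum v → rank u < rank v
rank-size-separated {ℓ} u@(_ ∷ _) (b ∷ s) |u|<|v| = <-≤-trans (rank-bound u)
  (≤-trans (monotone-by-steps (λ n → sumBelow n (G ℓ)) (λ n → m≤m+n _ _) |u|<|v|) (m≤m+n _ (rank s)))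

rank-injective : ∀ {ℓ} (u v : Vec ℕ ℓ) → rank u ≡ rank v → u ≡ v
rank-injective []              []      _ = refl
rank-injective {suc ℓ} (a ∷ t) (b ∷ s) ranks≡ with <-cmp (sum (a ∷ t)) (sum (b ∷ s))
... | tri< lt _ _ = ⊥-elim (<-irrefl ranks≡ (rank-size-separated (a ∷ t) (b ∷ s) lt))
... | tri> _ _ gt = ⊥-elim (<-irrefl (sym ranks≡) (rank-size-separated (b ∷ s) (a ∷ t) gt))
... | tri≈ _ sizes≡ _ = cong₂ _∷_ a≡b t≡s
  where
  t≡s : t ≡ s
  t≡s = rank-injective t s (+-cancelˡ-≡ (sumBelow (a + sum t) (G ℓ)) _ _
          (trans ranks≡ (cong (λ z → sumBelow z (G ℓ) + rank s) (sym sizes≡))))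
  a≡b : a ≡ b
  a≡b = +-cancelʳ-≡ (sum t) a b (trans sizes≡ (cong (λ z → b + sum z) (sym t≡s)))

segment : ∀ (f : ℕ → ℕ) m k → k < sumBelow (suc m) f →
  Σ ℕ λ j → j ≤ m × sumBelow j f ≤ k × k < sumBelow (suc j) f
segment f zero    k k< = 0 , z≤n , z≤n , k<
segment f (suc m) k k< with k <? sumBelow (suc m) f
... | yes k<′ = let j , j≤m , lower , upper = segment f m k k<′ in j , m≤n⇒m≤1+n j≤m , lower , upper
... | no  k≮  = suc m , ≤-refl , ≮⇒≥ k≮ , k<

rank-surjective : ∀ ℓ m k → k < G ℓ m → Σ (Vec ℕ ℓ) λ v → sum v ≤ m × rank v ≡ k
rank-surjective zero    m zero    _          = [] , z≤n , refl
rank-surjective zero    m (suc k) (s≤s ())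
rank-surjective (suc ℓ) m k       k<         with segment (G ℓ) m k k<
... | j , j≤m , lower , upper with rank-surjective ℓ j (k ∸ sumBelow j (G ℓ))
      (+-cancelˡ-< (sumBelow j (G ℓ)) _ _ (subst (_< sumBelow (suc j) (G ℓ)) (sym (m+[n∸m]≡n lower)) upper))
... | t , |t|≤j , rank-t = (j ∸ sum t) ∷ t , subst (_≤ m) (sym size≡j) j≤m ,
      trans (cong (λ z → sumBelow z (G ℓ) + rank t) size≡j)
            (trans (cong (sumBelow j (G ℓ) +_) rank-t) (m+[n∸m]≡n lower))
  where
  size≡j : j ∸ sum t + sum t ≡ j
  size≡j = m∸n+n≡m |t|≤j

infix 4 _<lex_
_<lex_ : ∀ {ℓ} → Word ℓ → Word ℓ → Set
_<lex_ = Lex-< _≡_ Fin._<_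

-- <lex is asymmetric, and its proofs are unique (as are those of <gen and
-- InB); uniqueness is needed to identify predecessors as Σ-type elements.
lex-asym : ∀ {ℓ} {v w : Word ℓ} → v <lex w → ¬ w <lex v
lex-asym = <-asymmetric sym Finₚ.<-resp₂-≡ Finₚ.<-asym

lex-irrelevant : ∀ {ℓ} {v w : Word ℓ} (l l′ : v <lex w) → l ≡ l′
lex-irrelevant (base ())
lex-irrelevant halt       halt        = refl
lex-irrelevant (this r)   (this r′)   = cong this (Finₚ.<-irrelevant r r′)
lex-irrelevant (this r)   (next refl _) = ⊥-elim (Finₚ.<-irrefl refl r)
lex-irrelevant (next refl _) (this r′) = ⊥-elim (Finₚ.<-irrefl refl r′)
lex-irrelevant (next e l) (next e′ l′) =
  cong₂ next (UIP.Decidable⇒UIP.≡-irrelevant _≟_ e e′) (lex-irrelevant l l′)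

lex-prefix : ∀ {ℓ} a {xs ys : Word (suc ℓ)} → xs <lex ys → replicate a fzero ++ xs <lex replicate a fzero ++ ys
lex-prefix zero    l = l
lex-prefix (suc a) l = next refl (lex-prefix a l)

lex-shift : ∀ {ℓ} {xs ys : Word ℓ} → xs <lex ys → List.map fsuc xs <lex List.map fsuc ys
lex-shift (base ())
lex-shift halt          = halt
lex-shift (this r)      = this (s≤s r)
lex-shift (next refl l) = next refl (lex-shift l)

lex-more-first : ∀ {ℓ} {a b} → b < a → (xs : Word (suc ℓ)) (y : Fin ℓ) (ys : Word (suc ℓ)) →
  replicate a fzero ++ xs <lex replicate b fzero ++ (fsuc y ∷ ys)
lex-more-first {a = suc a} {zero}  _           xs y ys = this (s≤s z≤n)
lex-more-first {a = suc a} {suc b} (s≤s b<a) xs y ys = next refl (lex-more-first b<a xs y ys)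

gen-irrefl : ∀ {ℓ} {w : Word ℓ} → ¬ w <gen w
gen-irrefl (inj₁ lt)      = <-irrefl refl lt
gen-irrefl (inj₂ (_ , l)) = lex-asym l l

gen-asym : ∀ {ℓ} {v w : Word ℓ} → v <gen w → ¬ w <gen v
gen-asym (inj₁ lt)      (inj₁ lt′)      = <-asym lt lt′
gen-asym (inj₁ lt)      (inj₂ (e , _))  = <-irrefl (sym e) lt
gen-asym (inj₂ (e , _)) (inj₁ lt′)      = <-irrefl (sym e) lt′
gen-asym (inj₂ (_ , l)) (inj₂ (_ , l′)) = lex-asym l l′

gen-irrelevant : ∀ {ℓ} {v w : Word ℓ} (l l′ : v <gen w) → l ≡ l′
gen-irrelevant (inj₁ lt)      (inj₁ lt′)       = cong inj₁ (<-irrelevant lt lt′)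
gen-irrelevant (inj₁ lt)      (inj₂ (e , _))   = ⊥-elim (<-irrefl e lt)
gen-irrelevant (inj₂ (e , _)) (inj₁ lt′)       = ⊥-elim (<-irrefl e lt′)
gen-irrelevant (inj₂ (e , l)) (inj₂ (e′ , l′)) =
  cong inj₂ (cong₂ _,_ (≡-irrelevant e e′) (lex-irrelevant l l′))

InB-irrelevant : ∀ {ℓ} {w : Word ℓ} (b b′ : InB w) → b ≡ b′
InB-irrelevant = Linked.irrelevant Finₚ.≤-irrelevant

-- word turns the order of ranks into genealogical order: a smaller rank
-- means a shorter word or, at equal length, a recursively smaller tail.
rank-<⇒gen : ∀ {ℓ} (u v : Vec ℕ ℓ) → rank u < rank v → word u <gen word v
rank-<⇒gen []              []      ()
rank-<⇒gen {suc ℓ} (a ∷ t) (b ∷ s) lt with <-cmp (sum (a ∷ t)) (sum (b ∷ s))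
... | tri< shorter _ _ = inj₁ (subst₂ _<_ (sym (length-word (a ∷ t))) (sym (length-word (b ∷ s))) shorter)
... | tri> _ _ longer  = ⊥-elim (<-asym lt (rank-size-separated (b ∷ s) (a ∷ t) longer))
... | tri≈ _ sizes≡ _  =
  inj₂ (trans (length-word (a ∷ t)) (trans sizes≡ (sym (length-word (b ∷ s)))) , tails (rank-<⇒gen t s tail<))
  where
  tail< : rank t < rank s
  tail< = +-cancelˡ-< (sumBelow (a + sum t) (G ℓ)) _ _
            (subst (λ z → sumBelow (a + sum t) (G ℓ) + rank t < sumBelow z (G ℓ) + rank s) (sym sizes≡) lt)
  -- Equal total size: a shorter tail means more leading a₁'s.
  tails : word t <gen word s → word (a ∷ t) <lex word (b ∷ s)
  tails (inj₁ shorter) = more-first (word s) shorter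
    where
    b<a : b < a
    b<a = ≰⇒> λ a≤b → <-irrefl sizes≡
      (+-mono-≤-< a≤b (subst₂ _<_ (length-word t) (length-word s) shorter))
    more-first : ∀ w → length (word t) < length w →
      replicate a fzero ++ List.map fsuc (word t) <lex replicate b fzero ++ List.map fsuc w
    more-first (y ∷ ys) _ = lex-more-first b<a (List.map fsuc (word t)) y (List.map fsuc ys)
  tails (inj₂ (lengths≡ , l)) = subst (λ z → word (z ∷ t) <lex word (b ∷ s)) (sym a≡b) (lex-prefix b (lex-shift l))
    where
    a≡b : a ≡ b
    a≡b = +-cancelʳ-≡ (sum t) a b
      (trans sizes≡ (cong (b +_) (trans (sym (length-word s)) (trans (sym lengths≡) (length-word t)))))

rank-gen⇒< : ∀ {ℓ} (u v : Vec ℕ ℓ) → word u <gen word v → rank u < rank v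
rank-gen⇒< u v u<v with <-cmp (rank u) (rank v)
... | tri< lt _ _ = lt
... | tri≈ _ e _  = ⊥-elim (gen-irrefl (subst (λ z → word u <gen word z) (sym (rank-injective u v e)) u<v))
... | tri> _ _ gt = ⊥-elim (gen-asym u<v (rank-<⇒gen v u gt))

Predecessors : ∀ {ℓ} → Word ℓ → Set
Predecessors {ℓ} w = Σ (Word ℓ) λ u → InB u × u <gen w

predecessors-count : ∀ {ℓ} (v : Vec ℕ ℓ) → Fin (rank v) ↔ Predecessors (word v)
predecessors-count {ℓ} v = mk↔ₛ′ (λ k → predecessor (toℕ k) (Finₚ.toℕ<n k)) (λ u → fromℕ< (index< u))
  (λ u → predecessor-index (Finₚ.toℕ-fromℕ< (index< u)))
  (λ k → Finₚ.toℕ-injective (trans (Finₚ.toℕ-fromℕ< _)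
    (trans (cong rank (Ψ-word (vector (Finₚ.toℕ<n k)))) (rank-vector (Finₚ.toℕ<n k)))))
  where
  surjection : ∀ {k} → k < rank v → Σ (Vec ℕ ℓ) λ u → sum u ≤ sum v × rank u ≡ k
  surjection {k} k< = rank-surjective ℓ (sum v) k (<-trans k< (rank-bound v))

  vector : ∀ {k} → k < rank v → Vec ℕ ℓ
  vector k< = proj₁ (surjection k<)

  rank-vector : ∀ {k} (k< : k < rank v) → rank (vector k<) ≡ k
  rank-vector k< = proj₂ (proj₂ (surjection k<))

  predecessor : ∀ k → k < rank v → Predecessors (word v)
  predecessor k k< = word (vector k<) , InB-word (vector k<) ,
    rank-<⇒gen (vector k<) v (subst (_< rank v) (sym (rank-vector k<)) k<)

  index< : (u : Predecessors (word v)) → rank (Ψ (proj₁ u)) < rank v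
  index< (u , u↗ , u<v) = rank-gen⇒< (Ψ u) v (subst (_<gen word v) (word-Ψ u u↗) u<v)

  predecessor-index : ∀ {k k<} {u : Predecessors (word v)} → k ≡ rank (Ψ (proj₁ u)) → predecessor k k< ≡ u
  predecessor-index {k} {k<} {u , u↗ , u<v} k≡ = same-word words≡ _ _ u↗ u<v
    where
    words≡ : word (vector k<) ≡ u
    words≡ = trans (cong word (rank-injective (vector k<) (Ψ u) (trans (rank-vector k<) k≡))) (sym (word-Ψ u u↗))
    same-word : ∀ {w w′} → w ≡ w′ → (b : InB w) (l : w <gen word v) (b′ : InB w′) (l′ : w′ <gen word v) →
      _≡_ {A = Predecessors (word v)} (w , b , l) (w′ , b′ , l′)
    same-word refl b l b′ l′ = cong₂ (λ b l → _ , b , l) (InB-irrelevant b b′) (gen-irrelevant l l′)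

IsRep⇒rank : ∀ {ℓ n} (w : Word ℓ) → IsRep ℓ n w → rank (Ψ w) ≡ n
IsRep⇒rank w (w↗ , count) = sym (↔⇒≡ (↔-trans count′ (↔-sym (predecessors-count (Ψ w)))))
  where
  count′ : Fin _ ↔ Predecessors (word (Ψ w))
  count′ = subst (λ z → _ ↔ Predecessors z) (word-Ψ w w↗) count

rank⇒IsRep : ∀ {ℓ} (v : Vec ℕ ℓ) → IsRep ℓ (rank v) (word v)
rank⇒IsRep v = InB-word v , predecessors-count v

G-periodic : ∀ {p} ℓ → Periodic p (p ^ ℓ) (G ℓ)
G-periodic zero    k = ≼-refl
G-periodic (suc ℓ) k = sumBelow-periodic (G-periodic ℓ) (suc k)

sum-translate : ∀ {ℓ} M (x ns : Vec ℕ ℓ) → sum (translate M x ns) ≡ sum x + M * sum ns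
sum-translate M []      []       = sym (*-zeroʳ M)
sum-translate M (a ∷ x) (n ∷ ns) = trans (cong (a + M * n +_) (sum-translate M x ns)) (regroup a (sum x) M n (sum ns))
  where
  regroup : ∀ a s M n S → a + M * n + (s + M * S) ≡ a + s + M * (n + S)
  regroup = solve-∀

rank-periodic : ∀ {p ℓ} c (x ns : Vec ℕ ℓ) → rank x ≼[ p ] rank (translate (c * p ^ ℓ) x ns)
rank-periodic             c []      []       = ≼-refl
rank-periodic {p} {suc ℓ} c (a ∷ t) (n ∷ ns) = ≼-+ first-block rest
  where
  M : ℕ
  M = c * p ^ suc ℓ
  first-block : sumBelow (a + sum t) (G ℓ) ≼[ p ] sumBelow (a + M * n + sum (translate M t ns)) (G ℓ)
  first-block = subst (λ z → sumBelow (a + sum t) (G ℓ) ≼[ p ] sumBelow z (G ℓ))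
    (trans (regroup a (sum t) c n (sum ns) (p ^ suc ℓ)) (cong (a + M * n +_) (sym (sum-translate M t ns))))
    (periodic-multiple (sumBelow-periodic (G-periodic ℓ)) (c * (n + sum ns)) (a + sum t))
    where
    regroup : ∀ a s c n S Q → a + s + c * (n + S) * Q ≡ a + c * Q * n + (s + c * Q * S)
    regroup = solve-∀
  rest : rank t ≼[ p ] rank (translate M t ns)
  rest = subst (λ z → rank t ≼[ p ] rank (translate z t ns)) (*-assoc c p (p ^ ℓ)) (rank-periodic (c * p) t ns)

-- The rank dominates the size: a vector of size s is preceded by at least
-- one vector of each smaller size.
size≤rank : ∀ {ℓ} (v : Vec ℕ ℓ) → sum v ≤ rank v
size≤rank []              = z≤n
size≤rank {suc ℓ} (a ∷ t) = ≤-trans (n≤sumBelow (a + sum t)) (m≤m+n _ (rank t))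
  where
  n≤sumBelow : ∀ n → n ≤ sumBelow n (G ℓ)
  n≤sumBelow zero    = z≤n
  n≤sumBelow (suc n) = subst (_≤ sumBelow n (G ℓ) + G ℓ n) (+-comm n 1) (+-mono-≤ (n≤sumBelow n) (G-positive ℓ n))

InΨrep⇔ : ∀ {ℓ p q} (v : Vec ℕ ℓ) → InΨrep ℓ p q v ⇔ q ≼[ p ] rank v
InΨrep⇔ {ℓ} v = mk⇔
  (λ (n , w , w-rep , Ψw≡v) → n , trans (cong rank (sym Ψw≡v)) (IsRep⇒rank w w-rep))
  (λ (n , rank≡) → n , word v , subst (λ z → IsRep ℓ z (word v)) rank≡ (rank⇒IsRep v) , Ψ-word v)

p≡0⊎p^ℓ≢0 : ∀ p ℓ → p ≡ 0 ⊎ NonZero (p ^ ℓ)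
p≡0⊎p^ℓ≢0 zero    ℓ = inj₁ refl
p≡0⊎p^ℓ≢0 (suc p) ℓ = inj₂ (m^n≢0 (suc p) ℓ)

-- Proposition 2.3: rank satisfies the semilinearity criterion with P = p^ℓ
-- (the argument does not need the hypothesis ℓ ≥ 1).
proposition23 : (ℓ p q : ℕ) → ℓ ≥ 1 →
    Σ ℕ (λ P → Σ (List (Vec ℕ ℓ)) (λ xs →
      (v : Vec ℕ ℓ) → InΨrep ℓ p q v ⇔ Σ (Vec ℕ ℓ) (λ x → x ∈ xs × InLinear P x v)))
proposition23 ℓ p q _ = p ^ ℓ , representatives , λ v →
  mk⇔ (complete (p≡0⊎p^ℓ≢0 p ℓ) v ∘ Equivalence.to (InΨrep⇔ v))
      (Equivalence.from (InΨrep⇔ v) ∘ sound v)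
  where
  periodic : ∀ x ns → rank x ≼[ p ] rank (translate (p ^ ℓ) x ns)
  periodic x ns = subst (λ M → rank x ≼[ p ] rank (translate M x ns)) (*-identityˡ (p ^ ℓ)) (rank-periodic 1 x ns)
  open PeriodicPreimage p q (p ^ ℓ) rank periodic size≤rank
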